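{- Let $n\ge2$, $d\ge1$, $r\ge1$ be integers with $n\ge d$. If $dr\equiv 0\pmod n$, then $Q_n^-(d,r)\cong Q_n(d,r)$.
   Context: For $1\le i\le n$ let $\mathbf e_i\in\mathbb Z_2^n$ be the $i$-th standard basis row vector, subscripts read modulo $n$. $Q_n^-(d,r)$ is the graph with vertex set $\mathbb Z_2^n\times\mathbb Z_r$ in which $(\mathbf a,x)$ and $(\mathbf b,y)$ are adjacent iff either $\mathbf a=\mathbf b$ and $x\equiv y\pm1\pmod r$, or $x\equiv y\pmod r$ and $\mathbf b=\mathbf a+\mathbf e_{i-dx}$ for some $1\le i\le d$. When $dr\equiv0\pmod n$: let $M$ be the $n\times n$ permutation matrix over $\mathbb F_2$ with $\mathbf e_iM=\mathbf e_{i+1}$, let $G=\mathbb Z_2^n\rtimes\mathbb Z_r$ be the group on $\mathbb Z_2^n\times\mathbb Z_r$ with product $(\mathbf a,x)(\mathbf b,y)=(\mathbf a+\mathbf bM^{dx},x+y)$, and let $Q_n(d,r)=\mathrm{Cay}(G,S)$ with $S=\{(\mathbf 0_n,1),(\mathbf 0_n,r-1),(\mathbf e_1,0),\dots,(\mathbf e_d,0)\}$, i.e. the neighbours of $(\mathbf a,x)$ are $(\mathbf a+\mathbf e_{i+dx},x)$, $1\le i\le d$, and $(\mathbf a,x\pm1)$. Graphs are simple (loops and multiple edges ignored). -}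

module Defs where

open import Data.Nat using (ℕ; zero; suc; _+_; _*_; _∸_; _≤_)
open import Data.Nat.DivMod using (_mod_)
open import Data.Bool using (Bool; true; false; _xor_)
open import Data.Fin using (Fin; toℕ; _≟_)
open import Data.Vec using (Vec; tabulate; lookup; zipWith; replicate)
open import Data.Product using (Σ; _×_; ∃; ∃-syntax; _,_)
open import Data.Sum using (_⊎_)
open import Relation.Nullary using (¬_; does)
open import Relation.Binary.PropositionalEquality using (_≡_)
open import Function.Bundles using (_↔_; _⇔_; Inverse)

-- Vertex set Z_2^n × Z_r; Z_2^n as bit vectors (0-based coordinates:
-- the paper's coordinate i (1 ≤ i ≤ n) is Fin index (i-1) mod n),
-- Z_r as Fin r (canonical representatives 0..r-1).
V : ℕ → ℕ → Set
V n r = Vec Bool n × Fin r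

-- reduce t modulo the size of the Fin type of j (which is nonzero)
modLike : {n : ℕ} → ℕ → Fin n → Fin n
modLike {suc m} t _ = t mod suc m

-- unit n t = standard basis vector with 0-based index t mod n,
-- i.e. the paper's e_{t+1} (subscripts mod n)
unit : (n : ℕ) → ℕ → Vec Bool n
unit n t = tabulate (λ j → does (j ≟ modLike t j))

_⊕_ : {n : ℕ} → Vec Bool n → Vec Bool n → Vec Bool n
_⊕_ = zipWith _xor_

-- b M^k where e_i M = e_{i+1}:  (b M^k)_j = b_{j-k}; note j-k ≡ j+(n-1)k (mod n)
shiftM : {n : ℕ} → ℕ → Vec Bool n → Vec Bool n
shiftM {n} k b = tabulate (λ j → lookup b (modLike (toℕ j + (n ∸ 1) * k) j))

plus1 : {r : ℕ} → Fin r → Fin r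
plus1 {suc m} x = suc (toℕ x) mod suc m

addF : {r : ℕ} → Fin r → Fin r → Fin r
addF {suc m} x y = (toℕ x + toℕ y) mod suc m

Graph : ℕ → ℕ → Set₁
Graph n r = V n r → V n r → Set

-- Q_n^-(d,r) (simple graph: loops removed by requiring u ≢ v).
-- Hypercube edges: x ≡ y and b = a + e_{i - d x}, 1 ≤ i ≤ d;
-- e_{i-dx} has 0-based index (i-1) - dx ≡ (i-1) + (n-1)dx (mod n).
QminusAdj : (n d r : ℕ) → Graph n r
QminusAdj n d r (a , x) (b , y) =
  ¬ ((a , x) ≡ (b , y)) ×
  ( (a ≡ b × (y ≡ plus1 x ⊎ x ≡ plus1 y))
  ⊎ (x ≡ y × ∃[ i ] (1 ≤ i × i ≤ d × b ≡ a ⊕ unit n ((i ∸ 1) + (n ∸ 1) * (d * toℕ x)))))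

-- the group G = Z_2^n ⋊ Z_r: (a,x)(b,y) = (a + b M^{dx}, x + y)
mulG : (n d r : ℕ) → V n r → V n r → V n r
mulG n d r (a , x) (b , y) = (a ⊕ shiftM (d * toℕ x) b , addF x y)

InS : (n d r : ℕ) → V n r → Set
InS n d r (b , y) =
  (b ≡ replicate n false × (toℕ y ≡ 1 ⊎ suc (toℕ y) ≡ r))
  ⊎ (toℕ y ≡ 0 × ∃[ i ] (1 ≤ i × i ≤ d × b ≡ unit n (i ∸ 1)))

QAdj : (n d r : ℕ) → Graph n r
QAdj n d r u v =
  ¬ (u ≡ v) ×
  ∃[ s ] (InS n d r s × (v ≡ mulG n d r u s ⊎ u ≡ mulG n d r v s))

Isomorphic : {A B : Set} → (A → A → Set) → (B → B → Set) → Set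
Isomorphic {A} {B} G H =
  Σ (A ↔ B) λ φ → ∀ u v → G u v ⇔ H (Inverse.to φ u) (Inverse.to φ v)

module Submission where

-- Both graphs live on Z_2^n × Z_r and their "vertical" edges
-- (a,x) ~ (a,x±1) are the same.  At level x the remaining edges of
-- Q_n^-(d,r) flip one of the coordinates i - dx (0 ≤ i ≤ d-1, 0-based,
-- indices mod n), whereas in Q_n(d,r) = Cay(G,S) they flip one of the
-- coordinates i + dx.  The reflection j ↦ (d-1) - j of Z_n carries the
-- first window onto the second, so (a,x) ↦ (a∘ρ, x), which permutes the
-- bits of a by this reflection ρ, is an isomorphism; being an involution
-- it is its own inverse.
--
-- The hypotheses d ≤ n and n ∣ dr are what
-- make G a group in the paper.

open import Defs
open import Data.Nat using (ℕ; zero; suc; _+_; _*_; _∸_; _%_; _≤_; s≤s; z≤n)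
open import Data.Nat.Properties using (+-comm; +-suc; +-identityʳ; m+[n∸m]≡n; m∸[m∸n]≡n; m∸n≤m)
open import Data.Nat.DivMod using (_mod_; %-distribˡ-+; %-distribˡ-*; [m+kn]%n≡m%n; m<n⇒m%n≡m; m%n<n; m%n%n≡m%n)
open import Data.Nat.Divisibility using (_∣_)
open import Data.Nat.Tactic.RingSolver using (solve-∀)
open import Data.Fin using (Fin; toℕ; fromℕ; _≟_)
open import Data.Fin.Properties using (toℕ-injective; toℕ-fromℕ<; toℕ-fromℕ; toℕ<n)
open import Data.Vec using (Vec; tabulate; lookup; replicate)
open import Data.Vec.Properties using (lookup∘tabulate; lookup-zipWith; lookup-replicate)
open import Data.Vec.Relation.Binary.Pointwise.Extensional using (ext; Pointwise-≡⇒≡)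
open import Data.Bool using (Bool; false; _xor_)
open import Data.Bool.Properties using (xor-assoc; xor-same; xor-identityʳ)
open import Data.Product using (_×_; ∃-syntax; _,_)
open import Data.Product.Properties using (,-injective)
open import Data.Sum using (_⊎_; inj₁; inj₂)
open import Relation.Nullary using (¬_; does)
open import Relation.Nullary.Decidable using (does-⇔)
open import Relation.Binary using (Setoid; IsEquivalence)
open import Relation.Binary.PropositionalEquality
open import Function using (_∘_)
open import Function.Bundles using (_⇔_; mk↔ₛ′; mk⇔)
open import Function.Properties.Equivalence using () renaming (refl to ⇔-refl; trans to ⇔-trans; sym to ⇔-sym)
open import Function.Related.TypeIsomorphisms using (¬-cong-⇔)
open import Data.Product.Function.NonDependent.Propositional using (_×-⇔_)
open import Data.Sum.Function.Propositional using (_⊎-⇔_)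

module Modular (m : ℕ) where
  N : ℕ
  N = suc m

  infix 4 _≈_
  record _≈_ (s t : ℕ) : Set where
    constructor ⟨_⟩
    field same-remainder : s % N ≡ t % N

  ≈-isEquivalence : IsEquivalence _≈_
  ≈-isEquivalence = record
    { refl  = ⟨ refl ⟩
    ; sym   = λ { ⟨ p ⟩ → ⟨ sym p ⟩ }
    ; trans = λ { ⟨ p ⟩ ⟨ q ⟩ → ⟨ trans p q ⟩ }
    }

  ≈-setoid : Setoid _ _
  ≈-setoid = record { isEquivalence = ≈-isEquivalence }

  open IsEquivalence ≈-isEquivalence public
    using () renaming (refl to ≈-refl; sym to ≈-sym; trans to ≈-trans)

  ≡⇒≈ : ∀ {s t} → s ≡ t → s ≈ t
  ≡⇒≈ refl = ≈-refl

  +-cong : ∀ {a b c e} → a ≈ b → c ≈ e → a + c ≈ b + e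
  +-cong {a} {b} {c} {e} ⟨ p ⟩ ⟨ q ⟩ = ⟨ begin
      (a + c) % N              ≡⟨ %-distribˡ-+ a c N ⟩
      (a % N + c % N) % N      ≡⟨ cong₂ (λ s t → (s + t) % N) p q ⟩
      (b % N + e % N) % N      ≡⟨ %-distribˡ-+ b e N ⟨
      (b + e) % N              ∎ ⟩
    where open ≡-Reasoning

  *-congˡ : ∀ a {b c} → b ≈ c → a * b ≈ a * c
  *-congˡ a {b} {c} ⟨ p ⟩ = ⟨ begin
      (a * b) % N              ≡⟨ %-distribˡ-* a b N ⟩
      (a % N * (b % N)) % N    ≡⟨ cong (λ t → (a % N * t) % N) p ⟩
      (a % N * (c % N)) % N    ≡⟨ %-distribˡ-* a c N ⟨
      (a * c) % N              ∎ ⟩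
    where open ≡-Reasoning

  -- Every congruence used below is witnessed by an identity a + pN = b + qN
  -- of natural numbers, which the ring solver checks.
  by-multiples : ∀ a b p q → a + p * N ≡ b + q * N → a ≈ b
  by-multiples a b p q eq = ⟨ begin
      a % N             ≡⟨ [m+kn]%n≡m%n a p N ⟨
      (a + p * N) % N   ≡⟨ cong (_% N) eq ⟩
      (b + q * N) % N   ≡⟨ [m+kn]%n≡m%n b q N ⟩
      b % N             ∎ ⟩
    where open ≡-Reasoning

  toℕ-mod : ∀ s → toℕ (s mod N) ≈ s
  toℕ-mod s = ⟨ trans (cong (_% N) (toℕ-fromℕ< (m%n<n s N))) (m%n%n≡m%n s N) ⟩

  ≈⇒≡ : ∀ {i j : Fin N} → toℕ i ≈ toℕ j → i ≡ j
  ≈⇒≡ {i} {j} ⟨ p ⟩ = toℕ-injective (begin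
      toℕ i       ≡⟨ m<n⇒m%n≡m (toℕ<n i) ⟨
      toℕ i % N   ≡⟨ p ⟩
      toℕ j % N   ≡⟨ m<n⇒m%n≡m (toℕ<n j) ⟩
      toℕ j       ∎)
    where open ≡-Reasoning

  ≡-mod⇔≈ : (j : Fin N) (t : ℕ) → (j ≡ t mod N) ⇔ (toℕ j ≈ t)
  ≡-mod⇔≈ j t = mk⇔
    (λ { refl → toℕ-mod t })
    (λ j≈t → ≈⇒≡ (≈-trans j≈t (≈-sym (toℕ-mod t))))

  mod-cong : ∀ {s t} → s ≈ t → s mod N ≡ t mod N
  mod-cong {s} {t} s≈t = ≈⇒≡ (≈-trans (toℕ-mod s) (≈-trans s≈t (≈-sym (toℕ-mod t))))

  mod≡mod⇔≈ : ∀ s t → (s mod N ≡ t mod N) ⇔ (s ≈ t)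
  mod≡mod⇔≈ s t = mk⇔
    (λ p → ≈-trans (≈-sym (toℕ-mod s)) (≈-trans (≡⇒≈ (cong toℕ p)) (toℕ-mod t)))
    mod-cong

  toℕ-mod-self : (j : Fin N) → toℕ j mod N ≡ j
  toℕ-mod-self j = ≈⇒≡ (toℕ-mod (toℕ j))

vec-ext : ∀ {n} {u v : Vec Bool n} → (∀ j → lookup u j ≡ lookup v j) → u ≡ v
vec-ext h = Pointwise-≡⇒≡ (ext h)

lookup-⊕ : ∀ {n} (a b : Vec Bool n) j → lookup (a ⊕ b) j ≡ lookup a j xor lookup b j
lookup-⊕ a b j = lookup-zipWith _xor_ j a b

⊕-identityʳ : ∀ {n} (a : Vec Bool n) → a ⊕ replicate n false ≡ a
⊕-identityʳ {n} a = vec-ext λ j → begin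
    lookup (a ⊕ replicate n false) j          ≡⟨ lookup-⊕ a _ j ⟩
    lookup a j xor lookup (replicate n false) j ≡⟨ cong (lookup a j xor_) (lookup-replicate j false) ⟩
    lookup a j xor false                       ≡⟨ xor-identityʳ _ ⟩
    lookup a j                                 ∎
  where open ≡-Reasoning

⊕-solve : ∀ {n} {a b e : Vec Bool n} → b ≡ a ⊕ e → a ≡ b ⊕ e
⊕-solve {a = a} {e = e} refl = sym (vec-ext λ j → begin
    lookup ((a ⊕ e) ⊕ e) j                    ≡⟨ lookup-⊕ (a ⊕ e) e j ⟩
    lookup (a ⊕ e) j xor lookup e j           ≡⟨ cong (_xor lookup e j) (lookup-⊕ a e j) ⟩
    (lookup a j xor lookup e j) xor lookup e j ≡⟨ xor-assoc (lookup a j) _ _ ⟩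
    lookup a j xor (lookup e j xor lookup e j) ≡⟨ cong (lookup a j xor_) (xor-same (lookup e j)) ⟩
    lookup a j xor false                       ≡⟨ xor-identityʳ _ ⟩
    lookup a j                                 ∎)
  where open ≡-Reasoning

Flip : ∀ {n} → ℕ → (ℕ → Vec Bool n) → Vec Bool n → Vec Bool n → Set
Flip d w a b = ∃[ i ] (1 ≤ i × i ≤ d × b ≡ a ⊕ w i)

Flip-sym : ∀ {n d w} {a b : Vec Bool n} → Flip d w a b → Flip d w b a
Flip-sym (i , 1≤i , i≤d , b≡a⊕w) = i , 1≤i , i≤d , ⊕-solve b≡a⊕w

flip-transport : ∀ {n d} {w w′ : ℕ → Vec Bool n} (f : Vec Bool n → Vec Bool n) →
  (∀ a b → f (a ⊕ b) ≡ f a ⊕ f b) →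
  (∀ i → 1 ≤ i → i ≤ d → ∃[ i′ ] (1 ≤ i′ × i′ ≤ d × f (w i) ≡ w′ i′)) →
  ∀ {a b} → Flip d w a b → Flip d w′ (f a) (f b)
flip-transport {w = w} f additive directions {a} (i , 1≤i , i≤d , refl)
  with directions i 1≤i i≤d
... | i′ , 1≤i′ , i′≤d , fw≡w′ = i′ , 1≤i′ , i′≤d , trans (additive a (w i)) (cong (f a ⊕_) fw≡w′)

-- The directions at offset D = d·x: in Q_n^-(d,r) the vectors e_{i-D}, in
-- Cay(G,S) the vectors e_i M^D = e_{i+D} (1 ≤ i ≤ d, paper's indexing).
minusDir : (n : ℕ) → ℕ → ℕ → Vec Bool n
minusDir n D i = unit n ((i ∸ 1) + (n ∸ 1) * D)

cayleyDir : (n : ℕ) → ℕ → ℕ → Vec Bool n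
cayleyDir n D i = shiftM D (unit n (i ∸ 1))

module Reindexing (m : ℕ) where
  open Modular m

  reindex : (ℕ → ℕ) → Vec Bool N → Vec Bool N
  reindex g b = tabulate (λ j → lookup b (g (toℕ j) mod N))

  lookup-reindex : ∀ g b j → lookup (reindex g b) j ≡ lookup b (g (toℕ j) mod N)
  lookup-reindex g b = lookup∘tabulate (λ j → lookup b (g (toℕ j) mod N))

  lookup-unit : ∀ t j → lookup (unit N t) j ≡ does (j ≟ t mod N)
  lookup-unit t = lookup∘tabulate (λ j → does (j ≟ t mod N))

  unit-cong : ∀ {s t} → s ≈ t → unit N s ≡ unit N t
  unit-cong {s} {t} s≈t = vec-ext λ j → begin
      lookup (unit N s) j  ≡⟨ lookup-unit s j ⟩
      does (j ≟ s mod N)   ≡⟨ cong (λ k → does (j ≟ k)) (mod-cong s≈t) ⟩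
      does (j ≟ t mod N)   ≡⟨ lookup-unit t j ⟨
      lookup (unit N t) j  ∎
    where open ≡-Reasoning

  record InverseMod (g h : ℕ → ℕ) : Set where
    field
      g-cong : ∀ {s t} → s ≈ t → g s ≈ g t
      h-cong : ∀ {s t} → s ≈ t → h s ≈ h t
      g∘h    : ∀ t → g (h t) ≈ t
      h∘g    : ∀ t → h (g t) ≈ t

  reindex-⊕ : ∀ g a b → reindex g (a ⊕ b) ≡ reindex g a ⊕ reindex g b
  reindex-⊕ g a b = vec-ext λ j → begin
      lookup (reindex g (a ⊕ b)) j                   ≡⟨ lookup-reindex g (a ⊕ b) j ⟩
      lookup (a ⊕ b) (g (toℕ j) mod N)              ≡⟨ lookup-⊕ a b _ ⟩
      lookup a (g (toℕ j) mod N) xor lookup b (g (toℕ j) mod N)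
        ≡⟨ cong₂ _xor_ (lookup-reindex g a j) (lookup-reindex g b j) ⟨
      lookup (reindex g a) j xor lookup (reindex g b) j ≡⟨ lookup-⊕ (reindex g a) (reindex g b) j ⟨
      lookup (reindex g a ⊕ reindex g b) j            ∎
    where open ≡-Reasoning

  reindex-zero : ∀ g → reindex g (replicate N false) ≡ replicate N false
  reindex-zero g = vec-ext λ j → begin
      lookup (reindex g (replicate N false)) j ≡⟨ lookup-reindex g (replicate N false) j ⟩
      lookup (replicate N false) (g (toℕ j) mod N) ≡⟨ lookup-replicate (g (toℕ j) mod N) false ⟩
      false ≡⟨ lookup-replicate j false ⟨
      lookup (replicate N false) j ∎
    where open ≡-Reasoning

  module _ {g h : ℕ → ℕ} (inv : InverseMod g h) where
    open InverseMod inv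

    transpose : ∀ s t → (g s ≈ t) ⇔ (s ≈ h t)
    transpose s t = mk⇔
      (λ gs≈t → ≈-trans (≈-sym (h∘g s)) (h-cong gs≈t))
      (λ s≈ht → ≈-trans (g-cong s≈ht) (g∘h t))

    reindex-unit : ∀ t → reindex g (unit N t) ≡ unit N (h t)
    reindex-unit t = vec-ext λ j → begin
        lookup (reindex g (unit N t)) j     ≡⟨ lookup-reindex g (unit N t) j ⟩
        lookup (unit N t) (g (toℕ j) mod N) ≡⟨ lookup-unit t (g (toℕ j) mod N) ⟩
        does (g (toℕ j) mod N ≟ t mod N)    ≡⟨ does-⇔ (same-position j) (g (toℕ j) mod N ≟ t mod N) (j ≟ h t mod N) ⟩
        does (j ≟ h t mod N)                ≡⟨ lookup-unit (h t) j ⟨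
        lookup (unit N (h t)) j             ∎
      where
      open ≡-Reasoning
      same-position : ∀ j → (g (toℕ j) mod N ≡ t mod N) ⇔ (j ≡ h t mod N)
      same-position j = ⇔-trans (mod≡mod⇔≈ (g (toℕ j)) t)
        (⇔-trans (transpose (toℕ j) t) (⇔-sym (≡-mod⇔≈ j (h t))))

    reindex-inverse : ∀ b → reindex g (reindex h b) ≡ b
    reindex-inverse b = vec-ext λ j → begin
        lookup (reindex g (reindex h b)) j           ≡⟨ lookup-reindex g (reindex h b) j ⟩
        lookup (reindex h b) (g (toℕ j) mod N)       ≡⟨ lookup-reindex h b _ ⟩
        lookup b (h (toℕ (g (toℕ j) mod N)) mod N)   ≡⟨ cong (lookup b) (mod-cong (back j)) ⟩
        lookup b (toℕ j mod N)                        ≡⟨ cong (lookup b) (toℕ-mod-self j) ⟩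
        lookup b j                                    ∎
      where
      open ≡-Reasoning
      back : ∀ j → h (toℕ (g (toℕ j) mod N)) ≈ toℕ j
      back j = ≈-trans (h-cong (toℕ-mod _)) (h∘g (toℕ j))

  -- j ↦ j - D and t ↦ t + D are inverse modulo N (as -D ≡ mD).
  shift-inverse : ∀ D → InverseMod (λ j → j + m * D) (λ t → t + D)
  shift-inverse D = record
    { g-cong = λ p → +-cong p ≈-refl
    ; h-cong = λ p → +-cong p ≈-refl
    ; g∘h    = λ t → by-multiples _ t 0 D (add-back t D m)
    ; h∘g    = λ j → by-multiples _ j 0 D (add-back' j D m)
    }
    where
    add-back : ∀ t D m → (t + D) + m * D + 0 * suc m ≡ t + D * suc m
    add-back = solve-∀
    add-back' : ∀ j D m → (j + m * D) + D + 0 * suc m ≡ j + D * suc m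
    add-back' = solve-∀

  -- The shift b ↦ bM^D is, by definition, reindexing along j ↦ j - D,
  -- so it sends e_t to e_{t+D}.
  shiftM-unit : ∀ D t → shiftM D (unit N t) ≡ unit N (t + D)
  shiftM-unit D = reindex-unit (shift-inverse D)

  shiftM-zero : ∀ D a → a ⊕ shiftM D (replicate N false) ≡ a
  shiftM-zero D a = trans (cong (a ⊕_) (reindex-zero (λ j → j + m * D))) (⊕-identityʳ a)

module Reflection (m c : ℕ) where
  open Modular m
  open Reindexing m

  -- c - j, written without subtraction: -j ≡ mj (mod N)
  ρ : ℕ → ℕ
  ρ j = c + m * j

  ρ-involutive : InverseMod ρ ρ
  ρ-involutive = record
    { g-cong = ρ-cong
    ; h-cong = ρ-cong
    ; g∘h    = ρρ
    ; h∘g    = ρρ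
    }
    where
    ρ-cong : ∀ {s t} → s ≈ t → ρ s ≈ ρ t
    ρ-cong p = +-cong (≈-refl {c}) (*-congˡ m p)
    twice : ∀ c m x → c + m * (c + m * x) + x * suc m ≡ x + (c + m * x) * suc m
    twice = solve-∀
    ρρ : ∀ x → ρ (ρ x) ≈ x
    ρρ x = by-multiples _ x x (c + m * x) (twice c m x)

  reflect : Vec Bool N → Vec Bool N
  reflect = reindex ρ

  reflect-reflect : ∀ a → reflect (reflect a) ≡ a
  reflect-reflect = reindex-inverse ρ-involutive

  reflect-injective : ∀ {a b} → reflect a ≡ reflect b → a ≡ b
  reflect-injective {a} {b} p = trans (sym (reflect-reflect a)) (trans (cong reflect p) (reflect-reflect b))

  -- ρ maps the window i - D (0 ≤ i ≤ c) onto the window e + D (0 ≤ e ≤ c),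
  -- reversing it: i - D ↦ (c - i) + D.
  ρ-window : ∀ i D → i ≤ c → ρ (i + m * D) ≈ (c ∸ i) + D
  ρ-window i D i≤c = subst (λ c′ → c′ + m * (i + m * D) ≈ (c ∸ i) + D) (m+[n∸m]≡n i≤c)
    (by-multiples _ _ D (i + m * D) (expand i (c ∸ i) D m))
    where
    expand : ∀ i e D m → (i + e) + m * (i + m * D) + D * suc m ≡ (e + D) + (i + m * D) * suc m
    expand = solve-∀

  reflect-window : ∀ i D → i ≤ c → reflect (unit N (i + m * D)) ≡ shiftM D (unit N (c ∸ i))
  reflect-window i D i≤c = begin
      reflect (unit N (i + m * D))  ≡⟨ reindex-unit ρ-involutive (i + m * D) ⟩
      unit N (ρ (i + m * D))        ≡⟨ unit-cong (ρ-window i D i≤c) ⟩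
      unit N ((c ∸ i) + D)          ≡⟨ shiftM-unit D (c ∸ i) ⟨
      shiftM D (unit N (c ∸ i))     ∎
    where open ≡-Reasoning

  reflect-window⁻ : ∀ i D → i ≤ c → reflect (shiftM D (unit N i)) ≡ unit N ((c ∸ i) + m * D)
  reflect-window⁻ i D i≤c = begin
      reflect (shiftM D (unit N i))                    ≡⟨ cong (reflect ∘ shiftM D ∘ unit N) (m∸[m∸n]≡n i≤c) ⟨
      reflect (shiftM D (unit N (c ∸ (c ∸ i))))        ≡⟨ cong reflect (reflect-window (c ∸ i) D (m∸n≤m c i)) ⟨
      reflect (reflect (unit N ((c ∸ i) + m * D)))     ≡⟨ reflect-reflect _ ⟩
      unit N ((c ∸ i) + m * D)                         ∎
    where open ≡-Reasoning

  reflect-flip : ∀ D {a b} → Flip (suc c) (minusDir N D) a b →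
    Flip (suc c) (cayleyDir N D) (reflect a) (reflect b)
  reflect-flip D = flip-transport reflect (reindex-⊕ ρ) λ
    { (suc i) (s≤s z≤n) (s≤s i≤c) → suc (c ∸ i) , s≤s z≤n , s≤s (m∸n≤m c i) , reflect-window i D i≤c }

  reflect-flip⁻ : ∀ D {a b} → Flip (suc c) (cayleyDir N D) a b →
    Flip (suc c) (minusDir N D) (reflect a) (reflect b)
  reflect-flip⁻ D = flip-transport reflect (reindex-⊕ ρ) λ
    { (suc i) (s≤s z≤n) (s≤s i≤c) → suc (c ∸ i) , s≤s z≤n , s≤s (m∸n≤m c i) , reflect-window⁻ i D i≤c }

  reflect-flip⇔ : ∀ D a b →
    Flip (suc c) (minusDir N D) a b ⇔ Flip (suc c) (cayleyDir N D) (reflect a) (reflect b)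
  reflect-flip⇔ D a b = mk⇔ (reflect-flip D)
    (subst₂ (Flip (suc c) (minusDir N D)) (reflect-reflect a) (reflect-reflect b) ∘ reflect-flip⁻ D)

module Cyclic (r′ : ℕ) where
  open Modular r′ renaming (N to R)

  toℕ-addF : ∀ (x y : Fin R) → toℕ (addF x y) ≈ toℕ x + toℕ y
  toℕ-addF x y = toℕ-mod (toℕ x + toℕ y)

  toℕ-plus1 : ∀ (x : Fin R) → toℕ (plus1 x) ≈ suc (toℕ x)
  toℕ-plus1 x = toℕ-mod (suc (toℕ x))

  addF-zero : ∀ x y → toℕ y ≡ 0 → addF x y ≡ x
  addF-zero x y y≡0 = ≈⇒≡ (≈-trans (toℕ-addF x y) (≡⇒≈ (trans (cong (toℕ x +_) y≡0) (+-identityʳ (toℕ x)))))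

  addF-one : ∀ x y → toℕ y ≡ 1 → addF x y ≡ plus1 x
  addF-one x y y≡1 = ≈⇒≡ (≈-trans (toℕ-addF x y)
    (≈-trans (≡⇒≈ (trans (cong (toℕ x +_) y≡1) (+-comm (toℕ x) 1))) (≈-sym (toℕ-plus1 x))))

  plus-R : ∀ (x y : Fin R) → suc (toℕ y) ≡ R → toℕ x + suc (toℕ y) ≈ toℕ x
  plus-R x y y+1≡R = subst (λ t → toℕ x + t ≈ toℕ x) (sym y+1≡R)
    (by-multiples (toℕ x + R) (toℕ x) 0 1 (add-R (toℕ x) R))
    where
    add-R : ∀ x R → x + R + 0 * R ≡ x + 1 * R
    add-R = solve-∀

  plus1-addF-last : ∀ x y → suc (toℕ y) ≡ R → plus1 (addF x y) ≡ x
  plus1-addF-last x y y+1≡R = ≈⇒≡ (begin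
      toℕ (plus1 (addF x y))  ≈⟨ toℕ-plus1 (addF x y) ⟩
      suc (toℕ (addF x y))    ≈⟨ +-cong (≈-refl {1}) (toℕ-addF x y) ⟩
      suc (toℕ x + toℕ y)     ≡⟨ +-suc (toℕ x) (toℕ y) ⟨
      toℕ x + suc (toℕ y)     ≈⟨ plus-R x y y+1≡R ⟩
      toℕ x                   ∎)
    where open import Relation.Binary.Reasoning.Setoid ≈-setoid

  addF-plus1-last : ∀ x y → suc (toℕ y) ≡ R → addF (plus1 x) y ≡ x
  addF-plus1-last x y y+1≡R = ≈⇒≡ (begin
      toℕ (addF (plus1 x) y)   ≈⟨ toℕ-addF (plus1 x) y ⟩
      toℕ (plus1 x) + toℕ y    ≈⟨ +-cong (toℕ-plus1 x) (≈-refl {toℕ y}) ⟩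
      suc (toℕ x) + toℕ y      ≡⟨ +-suc (toℕ x) (toℕ y) ⟨
      toℕ x + suc (toℕ y)      ≈⟨ plus-R x y y+1≡R ⟩
      toℕ x                    ∎)
    where open import Relation.Binary.Reasoning.Setoid ≈-setoid

Vertical : ∀ {n r} → V n r → V n r → Set
Vertical (a , x) (b , y) = a ≡ b × (y ≡ plus1 x ⊎ x ≡ plus1 y)

-- QminusAdj n d r is  u ≢ v  together with  Edge d (minusDir n).
Edge : ∀ {n r} → ℕ → (ℕ → ℕ → Vec Bool n) → V n r → V n r → Set
Edge d dir (a , x) (b , y) = Vertical (a , x) (b , y) ⊎ (x ≡ y × Flip d (dir (d * toℕ x)) a b)

Edge-sym : ∀ {n r d dir} {u v : V n r} → Edge d dir u v → Edge d dir v u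
Edge-sym (inj₁ (refl , inj₁ up))   = inj₁ (refl , inj₂ up)
Edge-sym (inj₁ (refl , inj₂ down)) = inj₁ (refl , inj₁ down)
Edge-sym (inj₂ (refl , flip))      = inj₂ (refl , Flip-sym flip)

module Cayley (m d r′ : ℕ) where
  open Modular m using (N)
  open Reindexing m using (shiftM-zero)
  open Cyclic r′
  open Modular r′ using () renaming (N to R)

  zero-vector : Vec Bool N
  zero-vector = replicate N false

  mul-vertical : ∀ a x y → mulG N d R (a , x) (zero-vector , y) ≡ (a , addF x y)
  mul-vertical a x y = cong (_, addF x y) (shiftM-zero (d * toℕ x) a)

  mul-level : ∀ a x e y → toℕ y ≡ 0 → mulG N d R (a , x) (e , y) ≡ (a ⊕ shiftM (d * toℕ x) e , x)
  mul-level a x e y y≡0 = cong (a ⊕ shiftM (d * toℕ x) e ,_) (addF-zero x y y≡0)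

  generator⇒edge : ∀ {s} u v → InS N d R s → v ≡ mulG N d R u s → Edge d (cayleyDir N) u v
  generator⇒edge {_ , t} (a , x) (b , y) (inj₁ (refl , inj₁ t≡1)) v≡us
    with ,-injective (trans v≡us (mul-vertical a x t))
  ... | refl , y≡x+t = inj₁ (refl , inj₁ (trans y≡x+t (addF-one x t t≡1)))
  generator⇒edge {_ , t} (a , x) (b , y) (inj₁ (refl , inj₂ t+1≡R)) v≡us
    with ,-injective (trans v≡us (mul-vertical a x t))
  ... | refl , refl = inj₁ (refl , inj₂ (sym (plus1-addF-last x t t+1≡R)))
  generator⇒edge {_ , t} (a , x) (b , y) (inj₂ (t≡0 , i , 1≤i , i≤d , refl)) v≡us
    with ,-injective (trans v≡us (mul-level a x (unit N (i ∸ 1)) t t≡0))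
  ... | refl , refl = inj₂ (refl , i , 1≤i , i≤d , refl)

  -- every edge is realised by a generator: (0,R-1) for vertical edges,
  -- (e_i,0) for horizontal ones
  edge⇒generator : ∀ u v → Edge d (cayleyDir N) u v →
    ∃[ s ] (InS N d R s × (v ≡ mulG N d R u s ⊎ u ≡ mulG N d R v s))
  edge⇒generator (a , x) (.a , y) (inj₁ (refl , inj₁ refl)) =
    (zero-vector , fromℕ r′) , inj₁ (refl , inj₂ (cong suc (toℕ-fromℕ r′))) ,
    inj₂ (sym (trans (mul-vertical a (plus1 x) (fromℕ r′))
                     (cong (a ,_) (addF-plus1-last x (fromℕ r′) (cong suc (toℕ-fromℕ r′))))))
  edge⇒generator (a , .(plus1 y)) (.a , y) (inj₁ (refl , inj₂ refl)) =
    (zero-vector , fromℕ r′) , inj₁ (refl , inj₂ (cong suc (toℕ-fromℕ r′))) ,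
    inj₁ (sym (trans (mul-vertical a (plus1 y) (fromℕ r′))
                     (cong (a ,_) (addF-plus1-last y (fromℕ r′) (cong suc (toℕ-fromℕ r′))))))
  edge⇒generator (a , x) (b , .x) (inj₂ (refl , i , 1≤i , i≤d , refl)) =
    (unit N (i ∸ 1) , Data.Fin.zero) , inj₂ (refl , i , 1≤i , i≤d , refl) ,
    inj₁ (sym (mul-level a x (unit N (i ∸ 1)) Data.Fin.zero refl))

  cayley-adjacency : ∀ u v → QAdj N d R u v ⇔ (¬ u ≡ v × Edge d (cayleyDir N) u v)
  cayley-adjacency u v = mk⇔
    (λ { (u≢v , s , s∈S , inj₁ v≡us) → u≢v , generator⇒edge u v s∈S v≡us
       ; (u≢v , s , s∈S , inj₂ u≡vs) → u≢v , Edge-sym {dir = cayleyDir N} (generator⇒edge v u s∈S u≡vs) })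
    (λ { (u≢v , edge) → u≢v , edge⇒generator u v edge })

module Isomorphism (m c r′ : ℕ) where
  open Modular m using (N)
  open Reflection m c
  open Cayley m (suc c) r′ using (cayley-adjacency)

  d r : ℕ
  d = suc c
  r = suc r′

  φ : V N r → V N r
  φ (a , x) = (reflect a , x)

  φ-involutive : ∀ u → φ (φ u) ≡ u
  φ-involutive (a , x) = cong (_, x) (reflect-reflect a)

  φ-≡⇔ : ∀ u v → (u ≡ v) ⇔ (φ u ≡ φ v)
  φ-≡⇔ u v = mk⇔ (cong φ) λ p → trans (sym (φ-involutive u)) (trans (cong φ p) (φ-involutive v))

  edges-correspond : ∀ u v → Edge d (minusDir N) u v ⇔ Edge d (cayleyDir N) (φ u) (φ v)
  edges-correspond (a , x) (b , y) = vertical ⊎-⇔ (⇔-refl ×-⇔ reflect-flip⇔ (d * toℕ x) a b)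
    where
    vertical : Vertical (a , x) (b , y) ⇔ Vertical (reflect a , x) (reflect b , y)
    vertical = mk⇔ (λ { (a≡b , step) → cong reflect a≡b , step })
                   (λ { (ra≡rb , step) → reflect-injective ra≡rb , step })

  adjacency : ∀ u v → QminusAdj N d r u v ⇔ QAdj N d r (φ u) (φ v)
  adjacency u v = ⇔-trans (¬-cong-⇔ (φ-≡⇔ u v) ×-⇔ edges-correspond u v)
                          (⇔-sym (cayley-adjacency (φ u) (φ v)))

  isomorphic : Isomorphic (QminusAdj N d r) (QAdj N d r)
  isomorphic = mk↔ₛ′ φ φ φ-involutive φ-involutive , adjacency

-- Lemma 2.6: if dr ≡ 0 (mod n) then Q_n^-(d,r) ≅ Q_n(d,r).
lemma2p6 : (n d r : ℕ) → 2 ≤ n → 1 ≤ d → 1 ≤ r → d ≤ n → n ∣ d * r →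
    Isomorphic (QminusAdj n d r) (QAdj n d r)
lemma2p6 (suc m) (suc c) (suc r′) _ _ _ _ _ = Isomorphism.isomorphic m c r′
lemma2p6 zero _ _ () _ _ _ _
lemma2p6 (suc _) zero _ _ () _ _ _
lemma2p6 (suc _) (suc _) zero _ _ () _ _
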